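{- Let $m,k$ be positive integers, let $i\neq j$ be non-negative integers, and let $\delta\in\mathbb{F}_{2^{2m}}$. Then $$f(x)=x+\left(\mathrm{Tr}_m^{2m}(x)^k+\delta\right)^{2^i}+\left(\mathrm{Tr}_m^{2m}(x)^k+\delta\right)^{2^j}$$ is a permutation polynomial of $\mathbb{F}_{2^{2m}}$ and, writing $C=\delta^{2^i}+\delta^{2^{i+m}}+\delta^{2^j}+\delta^{2^{j+m}}$, its compositional inverse over $\mathbb{F}_{2^{2m}}$ is $$f^{ -1}(x)=x+\left(\left(\mathrm{Tr}_m^{2m}(x)+C\right)^k+\delta\right)^{2^i}+\left(\left(\mathrm{Tr}_m^{2m}(x)+C\right)^k+\delta\right)^{2^j}.$$
   Context: $\mathrm{Tr}_m^{2m}(x)=x+x^{2^m}$ is the trace map from $\mathbb{F}_{2^{2m}}$ to $\mathbb{F}_{2^m}$. The compositional inverse of a permutation polynomial $F$ of a finite field $\mathbb{F}$ is the unique polynomial map $F^{ -1}$ with $F(F^{ -1}(x))=F^{ -1}(F(x))=x$ for all $x\in\mathbb{F}$. -}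

module Defs where

open import Level using (_⊔_)
open import Data.Nat as ℕ using (ℕ)
open import Data.Fin using (Fin)
open import Data.Product using (_×_; ∃)
open import Relation.Nullary using (¬_)
open import Relation.Binary.PropositionalEquality as ≡ using ()
open import Algebra.Bundles using (CommutativeRing; Semiring)
open import Function.Bundles using (Bijection)
open import Function.Definitions using (Bijective)

IsField : ∀ {c ℓ} → CommutativeRing c ℓ → Set (c ⊔ ℓ)
IsField R = ¬ (0# ≈ 1#) × (∀ x → ¬ (x ≈ 0#) → ∃ λ y → x * y ≈ 1#)
  where open CommutativeRing R

-- A field with exactly q elements (up to the ring's setoid equality).
-- Since finite fields of a given order are unique up to isomorphism,
-- "F_q" is modelled as an arbitrary such field.
IsFiniteFieldOfOrder : ∀ {c ℓ} → CommutativeRing c ℓ → ℕ → Set (c ⊔ ℓ)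
IsFiniteFieldOfOrder R q =
  IsField R × Bijection (≡.setoid (Fin q)) (CommutativeRing.setoid R)

module FieldOps {c ℓ} (R : CommutativeRing c ℓ) where
  open CommutativeRing R
  open import Algebra.Definitions.RawSemiring (Semiring.rawSemiring semiring) using (_^_) public

  Tr : ℕ → Carrier → Carrier
  Tr m x = x + x ^ (2 ℕ.^ m)

  fPoly : (m k i j : ℕ) → Carrier → Carrier → Carrier
  fPoly m k i j δ x =
    x + ((Tr m x ^ k + δ) ^ (2 ℕ.^ i)) + ((Tr m x ^ k + δ) ^ (2 ℕ.^ j))

  Cconst : (m i j : ℕ) → Carrier → Carrier
  Cconst m i j δ =
    δ ^ (2 ℕ.^ i) + δ ^ (2 ℕ.^ (i ℕ.+ m)) + δ ^ (2 ℕ.^ j) + δ ^ (2 ℕ.^ (j ℕ.+ m))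

  gPoly : (m k i j : ℕ) → Carrier → Carrier → Carrier
  gPoly m k i j δ x =
    x + (((Tr m x + Cconst m i j δ) ^ k + δ) ^ (2 ℕ.^ i))
      + (((Tr m x + Cconst m i j δ) ^ k + δ) ^ (2 ℕ.^ j))

  IsPermutationWithInverse : (Carrier → Carrier) → (Carrier → Carrier) → Set (c ⊔ ℓ)
  IsPermutationWithInverse F G =
    Bijective _≈_ _≈_ F × (∀ x → F (G x) ≈ x) × (∀ x → G (F x) ≈ x)

-- In a field with q elements, a ^ q ≈ a: for a ≠ 0 multiplication by a permutes the
-- field, so multiplying each of the q factors of ∏ₓ (x if x ≠ 0, else 1) by a multiplies
-- the product by a ^ q, but also by just a, the only change being at x = 0. As
-- q = 2 ^ (2m) is even, (-1) ^ q ≈ 1 forces characteristic two. Then φ n x = x ^ (2 ^ n)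
-- is additive and φ m is an involution, so Tr = id + φ m is additive, its values are
-- fixed by φ m, and Tr kills their powers. Writing f x = x + E (Tr x) with
-- E y = (y ^ k + δ) ^ (2 ^ i) + (y ^ k + δ) ^ (2 ^ j), this makes Tr (E (Tr x)) ≈ C, so
-- Tr (f x) ≈ Tr x + C, and x ↦ x + E (Tr x + C) undoes f because E y + E y ≈ 0.
{-# OPTIONS --safe #-}
module Submission where

open import Level using (_⊔_)
open import Defs
import Data.Nat as ℕ
open ℕ using (ℕ; zero; suc; s≤s; z≤n)
import Data.Nat.Properties as ℕ
open import Data.Fin using (Fin; punchIn)
open import Data.Fin.Properties using (punchInᵢ≢i) renaming (_≟_ to _≟ᶠ_)
open import Data.Fin.Permutation using (Permutation; _⟨$⟩ʳ_)
open import Data.Product using (_,_; proj₁; proj₂; _×_)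
open import Data.Bool using (if_then_else_)
open import Data.Maybe using (nothing)
open import Function.Base using (_∘_)
open import Function.Bundles using (Bijection; Inverse)
open import Function.Definitions using (Bijective; Congruent)
open import Function.Properties.Bijection using (Bijection⇒Inverse)
open import Function.Properties.Inverse using (Inverse⇒Injection)
import Function.Construct.Composition as Compose
import Function.Construct.Symmetry as Symmetry
import Function.Consequences.Setoid as FunctionConsequences
open import Relation.Nullary using (yes; no; does)
open import Relation.Nullary.Decidable using (via-injection; dec-true; dec-false)
open import Relation.Binary.Bundles using (Setoid)
open import Relation.Binary.Definitions using (Decidable)
open import Relation.Binary.PropositionalEquality as ≡ using (_≡_; _≢_)
open import Algebra.Bundles using (CommutativeRing; CommutativeMonoid; AbelianGroup)
open import Tactic.RingSolver.Core.AlmostCommutativeRing using (fromCommutativeRing)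
import Tactic.RingSolver.NonReflective as RingSolver
import Algebra.Properties.CommutativeMonoid.Sum as Sum
import Algebra.Properties.CommutativeSemigroup as CommutativeSemigroupProperties
import Algebra.Properties.Semiring.Exp as ExpProperties
import Algebra.Properties.Ring as RingProperties

module _ {c ℓ} (M : CommutativeMonoid c ℓ) where
  open CommutativeMonoid M
  open Sum M using (sum; sum-remove; sum-permute; sum-cong-≋; sum-replicate-zero)
  open import Relation.Binary.Reasoning.Setoid setoid

  sum-single : ∀ {n} (t : Fin n → Carrier) (z : Fin n) →
               (∀ j → j ≢ z → t j ≈ ε) → sum t ≈ t z
  sum-single {suc n} t z t≈ε = begin
    sum t                              ≈⟨ sum-remove {i = z} t ⟩
    t z ∙ sum (λ j → t (punchIn z j))  ≈⟨ ∙-congˡ (sum-cong-≋ (λ j → t≈ε _ (punchInᵢ≢i z j))) ⟩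
    t z ∙ sum {n} (λ _ → ε)            ≈⟨ ∙-congˡ (sum-replicate-zero n) ⟩
    t z ∙ ε                            ≈⟨ identityʳ (t z) ⟩
    t z                                ∎

  sum-reindex : ∀ {a ℓa} {S : Setoid a ℓa} {q} (enum : Inverse (≡.setoid (Fin q)) S)
                (u : Setoid.Carrier S → Carrier) → Congruent (Setoid._≈_ S) _≈_ u →
                (h : Inverse S S) →
                sum (λ i → u (Inverse.to h (Inverse.to enum i)))
                  ≈ sum (λ i → u (Inverse.to enum i))
  sum-reindex {q = q} enum u u-cong h = sym (begin
    sum (u ∘ to enum)                   ≈⟨ sum-permute (u ∘ to enum) π ⟩
    sum (λ i → u (to enum (π ⟨$⟩ʳ i)))  ≈⟨ sum-cong-≋ {q} (λ i → u-cong (strictlyInverseˡ enum _)) ⟩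
    sum (u ∘ to h ∘ to enum)            ∎)
    where
    open Inverse using (to; strictlyInverseˡ)
    π : Permutation q q
    π = Compose.inverse (Compose.inverse enum h) (Symmetry.inverse enum)

module _ {a ℓ} (G : AbelianGroup a ℓ) where
  open AbelianGroup G
  open FunctionConsequences setoid setoid
  open import Relation.Binary.Reasoning.Setoid setoid

  shear-inverse : (∀ x → x ∙ x ≈ ε) →
    (L : Carrier → Carrier) → Congruent _≈_ _≈_ L → (∀ x y → L (x ∙ y) ≈ L x ∙ L y) →
    (E : Carrier → Carrier) → Congruent _≈_ _≈_ E →
    (d : Carrier) → (∀ x → L (E (L x)) ≈ L d) →
    {f g : Carrier → Carrier} →
    (∀ x → f x ≈ x ∙ E (L x)) → (∀ x → g x ≈ x ∙ E (L x ∙ L d)) →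
    Bijective _≈_ _≈_ f × (∀ x → f (g x) ≈ x) × (∀ x → g (f x) ≈ x)
  shear-inverse x∙x≈ε L L-cong L-homo E E-cong d L∘E∘L≈Ld {f} {g} f-def g-def =
    inverseᵇ⇒bijective (strictlyInverseˡ⇒inverseˡ f-cong f∘g , strictlyInverseʳ⇒inverseʳ g-cong g∘f)
    , f∘g , g∘f
    where
    cancel : ∀ {x y z} → y ≈ z → (x ∙ y) ∙ z ≈ x
    cancel {x} {y} {z} y≈z = begin
      (x ∙ y) ∙ z   ≈⟨ assoc x y z ⟩
      x ∙ (y ∙ z)   ≈⟨ ∙-congˡ (trans (∙-congʳ y≈z) (x∙x≈ε z)) ⟩
      x ∙ ε         ≈⟨ identityʳ x ⟩
      x             ∎

    L[x∙E[y]] : ∀ x {y} → L (E y) ≈ L d → L (x ∙ E y) ≈ L x ∙ L d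
    L[x∙E[y]] x L[E[y]]≈Ld = trans (L-homo x _) (∙-congˡ L[E[y]]≈Ld)

    L∘f : ∀ x → L (f x) ≈ L x ∙ L d
    L∘f x = trans (L-cong (f-def x)) (L[x∙E[y]] x (L∘E∘L≈Ld x))

    L∘g : ∀ x → L (g x) ≈ L x ∙ L d
    L∘g x = trans (L-cong (g-def x))
                  (L[x∙E[y]] x (trans (L-cong (E-cong (sym (L-homo x d)))) (L∘E∘L≈Ld (x ∙ d))))

    f∘g : ∀ x → f (g x) ≈ x
    f∘g x = begin
      f (g x)                                   ≈⟨ f-def (g x) ⟩
      g x ∙ E (L (g x))                         ≈⟨ ∙-cong (g-def x) (E-cong (L∘g x)) ⟩
      (x ∙ E (L x ∙ L d)) ∙ E (L x ∙ L d)       ≈⟨ cancel refl ⟩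
      x                                         ∎

    g∘f : ∀ x → g (f x) ≈ x
    g∘f x = begin
      g (f x)                                   ≈⟨ g-def (f x) ⟩
      f x ∙ E (L (f x) ∙ L d)                   ≈⟨ ∙-cong (f-def x) (E-cong L[fx]∙Ld≈Lx) ⟩
      (x ∙ E (L x)) ∙ E (L x)                   ≈⟨ cancel refl ⟩
      x                                         ∎
      where
      L[fx]∙Ld≈Lx : L (f x) ∙ L d ≈ L x
      L[fx]∙Ld≈Lx = trans (∙-congʳ (L∘f x)) (cancel refl)

    f-cong : Congruent _≈_ _≈_ f
    f-cong {x} {y} x≈y = trans (f-def x) (trans (∙-cong x≈y (E-cong (L-cong x≈y))) (sym (f-def y)))

    g-cong : Congruent _≈_ _≈_ g
    g-cong {x} {y} x≈y =
      trans (g-def x) (trans (∙-cong x≈y (E-cong (∙-congʳ (L-cong x≈y)))) (sym (g-def y)))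

module FiniteField {c ℓ} (F : CommutativeRing c ℓ) (isField : IsField F) {q : ℕ}
                   (enumeration : Bijection (≡.setoid (Fin q)) (CommutativeRing.setoid F)) where
  open CommutativeRing F
  open FieldOps F using (_^_)
  open ExpProperties semiring using (^-congˡ)
  open Sum *-commutativeMonoid using (sum-replicate; ∑-distrib-+; sum-cong-≋) renaming (sum to ∏)
  open FunctionConsequences setoid setoid
  open import Relation.Binary.Reasoning.Setoid setoid

  enum : Inverse (≡.setoid (Fin q)) setoid
  enum = Bijection⇒Inverse enumeration

  open Inverse enum using (strictlyInverseˡ; strictlyInverseʳ)
    renaming (to to element; from to index; from-cong to index-cong)

  _≈?_ : Decidable _≈_
  _≈?_ = via-injection (Inverse⇒Injection (Symmetry.inverse enum)) _≟ᶠ_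

  x*y≈1⇒x*[y*z]≈z : ∀ {x y} → x * y ≈ 1# → ∀ z → x * (y * z) ≈ z
  x*y≈1⇒x*[y*z]≈z {x} {y} xy≈1 z = begin
    x * (y * z)  ≈⟨ *-assoc x y z ⟨
    (x * y) * z  ≈⟨ *-congʳ xy≈1 ⟩
    1# * z       ≈⟨ *-identityˡ z ⟩
    z            ∎

  *-cancelˡ-nonzero : ∀ {x y z} → x ≉ 0# → x * y ≈ x * z → y ≈ z
  *-cancelˡ-nonzero {x} {y} {z} x≉0 xy≈xz with proj₂ isField x x≉0
  ... | x⁻¹ , xx⁻¹≈1 = begin
    y               ≈⟨ x⁻¹x≈1 y ⟨
    x⁻¹ * (x * y)   ≈⟨ *-congˡ xy≈xz ⟩
    x⁻¹ * (x * z)   ≈⟨ x⁻¹x≈1 z ⟩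
    z               ∎
    where
    x⁻¹x≈1 : ∀ w → x⁻¹ * (x * w) ≈ w
    x⁻¹x≈1 = x*y≈1⇒x*[y*z]≈z (trans (*-comm x⁻¹ x) xx⁻¹≈1)

  x*y≉0 : ∀ {x y} → x ≉ 0# → y ≉ 0# → x * y ≉ 0#
  x*y≉0 {x} x≉0 y≉0 xy≈0 = y≉0 (*-cancelˡ-nonzero x≉0 (trans xy≈0 (sym (zeroʳ x))))

  ∏-nonzero : ∀ {n} (t : Fin n → Carrier) → (∀ i → t i ≉ 0#) → ∏ t ≉ 0#
  ∏-nonzero {zero}  t _   1≈0 = proj₁ isField (sym 1≈0)
  ∏-nonzero {suc n} t t≉0 = x*y≉0 (t≉0 Fin.zero) (∏-nonzero (t ∘ Fin.suc) (t≉0 ∘ Fin.suc))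

  scaling : ∀ {a b} → a * b ≈ 1# → Inverse setoid setoid
  scaling {a} {b} ab≈1 = record
    { to        = a *_
    ; from      = b *_
    ; to-cong   = *-congˡ
    ; from-cong = *-congˡ
    ; inverse   = strictlyInverseˡ⇒inverseˡ *-congˡ (x*y≈1⇒x*[y*z]≈z ab≈1)
                , strictlyInverseʳ⇒inverseʳ *-congˡ (x*y≈1⇒x*[y*z]≈z (trans (*-comm b a) ab≈1))
    }

  ifZero_then_else_ : Carrier → Carrier → Carrier → Carrier
  ifZero x then b else c = if does (x ≈? 0#) then b else c

  ifZero-≈0 : ∀ {x} b c → x ≈ 0# → ifZero x then b else c ≡ b
  ifZero-≈0 {x} b c x≈0 = ≡.cong (if_then b else c) (dec-true (x ≈? 0#) x≈0)

  ifZero-≉0 : ∀ {x} b c → x ≉ 0# → ifZero x then b else c ≡ c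
  ifZero-≉0 {x} b c x≉0 = ≡.cong (if_then b else c) (dec-false (x ≈? 0#) x≉0)

  nonzeroOr1 : Carrier → Carrier
  nonzeroOr1 x = ifZero x then 1# else x

  nonzeroOr1-cong : Congruent _≈_ _≈_ nonzeroOr1
  nonzeroOr1-cong {x} {y} x≈y with x ≈? 0#
  ... | yes x≈0 = begin
    nonzeroOr1 x  ≡⟨ ifZero-≈0 1# x x≈0 ⟩
    1#            ≡⟨ ifZero-≈0 1# y (trans (sym x≈y) x≈0) ⟨
    nonzeroOr1 y  ∎
  ... | no x≉0 = begin
    nonzeroOr1 x  ≡⟨ ifZero-≉0 1# x x≉0 ⟩
    x             ≈⟨ x≈y ⟩
    y             ≡⟨ ifZero-≉0 1# y (x≉0 ∘ trans x≈y) ⟨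
    nonzeroOr1 y  ∎

  nonzeroOr1-nonzero : ∀ x → nonzeroOr1 x ≉ 0#
  nonzeroOr1-nonzero x with x ≈? 0#
  ... | yes x≈0 = λ n≈0 → proj₁ isField (trans (sym n≈0) (reflexive (ifZero-≈0 1# x x≈0)))
  ... | no x≉0  = x≉0 ∘ trans (sym (reflexive (ifZero-≉0 1# x x≉0)))

  *-nonzeroOr1 : ∀ {a} → a ≉ 0# → ∀ x →
                 a * nonzeroOr1 x ≈ nonzeroOr1 (a * x) * (ifZero x then a else 1#)
  *-nonzeroOr1 {a} a≉0 x with x ≈? 0#
  ... | yes x≈0 = begin
    a * nonzeroOr1 x
      ≡⟨ ≡.cong (a *_) (ifZero-≈0 1# x x≈0) ⟩
    a * 1#
      ≈⟨ *-comm a 1# ⟩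
    1# * a
      ≡⟨ ≡.cong₂ _*_ (ifZero-≈0 1# _ ax≈0) (ifZero-≈0 a 1# x≈0) ⟨
    nonzeroOr1 (a * x) * (ifZero x then a else 1#)
      ∎
    where
    ax≈0 : a * x ≈ 0#
    ax≈0 = trans (*-congˡ x≈0) (zeroʳ a)
  ... | no x≉0 = begin
    a * nonzeroOr1 x
      ≡⟨ ≡.cong (a *_) (ifZero-≉0 1# x x≉0) ⟩
    a * x
      ≈⟨ *-identityʳ (a * x) ⟨
    (a * x) * 1#
      ≡⟨ ≡.cong₂ _*_ (ifZero-≉0 1# _ (x*y≉0 a≉0 x≉0)) (ifZero-≉0 a 1# x≉0) ⟨
    nonzeroOr1 (a * x) * (ifZero x then a else 1#)
      ∎

  ∏-ifZero : ∀ a → ∏ (λ i → ifZero element i then a else 1#) ≈ a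
  ∏-ifZero a = trans (sum-single *-commutativeMonoid _ (index 0#) off-zero)
                     (reflexive (ifZero-≈0 a 1# (strictlyInverseˡ 0#)))
    where
    off-zero : ∀ j → j ≢ index 0# → ifZero element j then a else 1# ≈ 1#
    off-zero j j≢0 = reflexive (ifZero-≉0 a 1# (λ ej≈0 → j≢0 (j≡index0 ej≈0)))
      where
      j≡index0 : element j ≈ 0# → j ≡ index 0#
      j≡index0 ej≈0 = ≡.trans (≡.sym (strictlyInverseʳ j)) (index-cong ej≈0)

  0^n≈0 : ∀ {n} → Fin n → 0# ^ n ≈ 0#
  0^n≈0 {suc n} _ = zeroˡ (0# ^ n)

  fermat : ∀ a → a ^ q ≈ a
  fermat a with a ≈? 0#
  ... | yes a≈0 = trans (^-congˡ q a≈0) (trans (0^n≈0 (index 0#)) (sym a≈0))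
  ... | no a≉0 with proj₂ isField a a≉0
  ... | a⁻¹ , aa⁻¹≈1 = *-cancelˡ-nonzero (∏-nonzero _ (nonzeroOr1-nonzero ∘ element)) (begin
    Q * a ^ q
      ≈⟨ *-comm Q (a ^ q) ⟩
    a ^ q * Q
      ≈⟨ *-congʳ (sum-replicate q) ⟨
    ∏ {q} (λ _ → a) * Q
      ≈⟨ ∑-distrib-+ (λ _ → a) (nonzeroOr1 ∘ element) ⟨
    ∏ (λ i → a * nonzeroOr1 (element i))
      ≈⟨ sum-cong-≋ {q} (λ i → *-nonzeroOr1 a≉0 (element i)) ⟩
    ∏ (λ i → nonzeroOr1 (a * element i) * (ifZero element i then a else 1#))
      ≈⟨ ∑-distrib-+ {q} _ _ ⟩
    ∏ (λ i → nonzeroOr1 (a * element i)) * ∏ (λ i → ifZero element i then a else 1#)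
      ≈⟨ *-cong reindex (∏-ifZero a) ⟩
    Q * a
      ∎)
    where
    Q : Carrier
    Q = ∏ (nonzeroOr1 ∘ element)
    reindex : ∏ (λ i → nonzeroOr1 (a * element i)) ≈ Q
    reindex = sum-reindex *-commutativeMonoid enum nonzeroOr1 nonzeroOr1-cong (scaling aa⁻¹≈1)

HasCharacteristicTwo : ∀ {c ℓ} → CommutativeRing c ℓ → Set (c ⊔ ℓ)
HasCharacteristicTwo R = ∀ x → x + x ≈ 0#
  where open CommutativeRing R

module _ {c ℓ} (R : CommutativeRing c ℓ) where
  open CommutativeRing R
  open FieldOps R using (_^_)
  open ExpProperties semiring using (^-congˡ; ^-assocʳ)
  open RingProperties ring using (-1*x≈-x; -‿involutive)
  open import Relation.Binary.Reasoning.Setoid setoid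

  1^n≈1 : ∀ n → 1# ^ n ≈ 1#
  1^n≈1 zero    = refl
  1^n≈1 (suc n) = trans (*-identityˡ (1# ^ n)) (1^n≈1 n)

  [-1]^2≈1 : (- 1#) ^ 2 ≈ 1#
  [-1]^2≈1 = begin
    - 1# * (- 1# * 1#)  ≈⟨ *-congˡ (*-identityʳ (- 1#)) ⟩
    - 1# * - 1#         ≈⟨ -1*x≈-x (- 1#) ⟩
    - - 1#              ≈⟨ -‿involutive 1# ⟩
    1#                  ∎

  x^[2^[1+n]]≈x⇒characteristic-two : ∀ n → (∀ x → x ^ (2 ℕ.^ suc n) ≈ x) → HasCharacteristicTwo R
  x^[2^[1+n]]≈x⇒characteristic-two n x^[2^[1+n]]≈x x = begin
    x + x            ≈⟨ +-congˡ x≈-x ⟩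
    x + - x          ≈⟨ -‿inverseʳ x ⟩
    0#               ∎
    where
    -1≈1 : - 1# ≈ 1#
    -1≈1 = begin
      - 1#                         ≈⟨ x^[2^[1+n]]≈x (- 1#) ⟨
      (- 1#) ^ (2 ℕ.* 2 ℕ.^ n)     ≈⟨ ^-assocʳ (- 1#) 2 (2 ℕ.^ n) ⟨
      ((- 1#) ^ 2) ^ (2 ℕ.^ n)     ≈⟨ ^-congˡ (2 ℕ.^ n) [-1]^2≈1 ⟩
      1# ^ (2 ℕ.^ n)               ≈⟨ 1^n≈1 (2 ℕ.^ n) ⟩
      1#                           ∎
    x≈-x : x ≈ - x
    x≈-x = begin
      x          ≈⟨ *-identityˡ x ⟨
      1# * x     ≈⟨ *-congʳ -1≈1 ⟨
      - 1# * x   ≈⟨ -1*x≈-x x ⟩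
      - x        ∎

module Frobenius {c ℓ} (R : CommutativeRing c ℓ) (x+x≈0 : HasCharacteristicTwo R) where
  open CommutativeRing R
  open FieldOps R using (_^_; Tr; Cconst; fPoly; gPoly)
  open ExpProperties semiring using (^-congˡ; ^-congʳ; ^-homo-*; ^-assocʳ)
  open CommutativeSemigroupProperties +-commutativeSemigroup using (interchange)
  open RingSolver (fromCommutativeRing R (λ _ → nothing)) using (solve; _⊜_; _⊕_; _⊗_)
  open import Relation.Binary.Reasoning.Setoid setoid

  φ : ℕ → Carrier → Carrier
  φ n x = x ^ (2 ℕ.^ n)

  φ-cong : ∀ n {x y} → x ≈ y → φ n x ≈ φ n y
  φ-cong n = ^-congˡ (2 ℕ.^ n)

  φ-suc : ∀ n x → φ (suc n) x ≈ φ n x * φ n x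
  φ-suc n x = trans (^-homo-* x (2 ℕ.^ n) (2 ℕ.^ n ℕ.+ 0))
                    (*-congˡ (^-congʳ x (ℕ.+-identityʳ (2 ℕ.^ n))))

  [x+y]²≈x²+y² : ∀ x y → (x + y) * (x + y) ≈ x * x + y * y
  [x+y]²≈x²+y² x y = begin
    (x + y) * (x + y)                  ≈⟨ binomial x y ⟩
    x * x + y * y + (x * y + x * y)    ≈⟨ +-congˡ (x+x≈0 (x * y)) ⟩
    x * x + y * y + 0#                 ≈⟨ +-identityʳ _ ⟩
    x * x + y * y                      ∎
    where
    binomial : ∀ x y → (x + y) * (x + y) ≈ x * x + y * y + (x * y + x * y)
    binomial = solve 2 (λ x y → ((x ⊕ y) ⊗ (x ⊕ y)) ⊜ (x ⊗ x ⊕ y ⊗ y ⊕ (x ⊗ y ⊕ x ⊗ y))) refl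

  φ-+ : ∀ n x y → φ n (x + y) ≈ φ n x + φ n y
  φ-+ zero    x y = trans (*-identityʳ (x + y)) (sym (+-cong (*-identityʳ x) (*-identityʳ y)))
  φ-+ (suc n) x y = begin
    φ (suc n) (x + y)                    ≈⟨ φ-suc n (x + y) ⟩
    φ n (x + y) * φ n (x + y)            ≈⟨ *-cong (φ-+ n x y) (φ-+ n x y) ⟩
    (φ n x + φ n y) * (φ n x + φ n y)    ≈⟨ [x+y]²≈x²+y² (φ n x) (φ n y) ⟩
    φ n x * φ n x + φ n y * φ n y        ≈⟨ +-cong (φ-suc n x) (φ-suc n y) ⟨
    φ (suc n) x + φ (suc n) y            ∎

  φ-^ : ∀ n x k → φ n (x ^ k) ≈ φ n x ^ k
  φ-^ n x k = begin
    (x ^ k) ^ (2 ℕ.^ n)   ≈⟨ ^-assocʳ x k (2 ℕ.^ n) ⟩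
    x ^ (k ℕ.* 2 ℕ.^ n)   ≡⟨ ≡.cong (x ^_) (ℕ.*-comm k (2 ℕ.^ n)) ⟩
    x ^ (2 ℕ.^ n ℕ.* k)   ≈⟨ ^-assocʳ x (2 ℕ.^ n) k ⟨
    φ n x ^ k             ∎

  φ∘φ : ∀ a b x → φ a (φ b x) ≈ φ (a ℕ.+ b) x
  φ∘φ a b x = begin
    (x ^ (2 ℕ.^ b)) ^ (2 ℕ.^ a)   ≈⟨ ^-assocʳ x (2 ℕ.^ b) (2 ℕ.^ a) ⟩
    x ^ (2 ℕ.^ b ℕ.* 2 ℕ.^ a)     ≡⟨ ≡.cong (x ^_) (ℕ.*-comm (2 ℕ.^ b) (2 ℕ.^ a)) ⟩
    x ^ (2 ℕ.^ a ℕ.* 2 ℕ.^ b)     ≡⟨ ≡.cong (x ^_) (ℕ.^-distribˡ-+-* 2 a b) ⟨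
    φ (a ℕ.+ b) x                 ∎

  φ-comm : ∀ a b x → φ a (φ b x) ≈ φ b (φ a x)
  φ-comm a b x = begin
    φ a (φ b x)     ≈⟨ φ∘φ a b x ⟩
    φ (a ℕ.+ b) x   ≡⟨ ≡.cong (λ n → φ n x) (ℕ.+-comm a b) ⟩
    φ (b ℕ.+ a) x   ≈⟨ φ∘φ b a x ⟨
    φ b (φ a x)     ∎

  φ[2m]≈id⇒φm-involutive : ∀ m → (∀ x → φ (2 ℕ.* m) x ≈ x) → ∀ x → φ m (φ m x) ≈ x
  φ[2m]≈id⇒φm-involutive m φ[2m]≈id x = begin
    φ m (φ m x)     ≈⟨ φ∘φ m m x ⟩
    φ (m ℕ.+ m) x   ≡⟨ ≡.cong (λ n → φ (m ℕ.+ n) x) (ℕ.+-identityʳ m) ⟨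
    φ (2 ℕ.* m) x   ≈⟨ φ[2m]≈id x ⟩
    x               ∎

  module Trace (m : ℕ) (φm-involutive : ∀ x → φ m (φ m x) ≈ x) where

    Tr-cong : ∀ {x y} → x ≈ y → Tr m x ≈ Tr m y
    Tr-cong x≈y = +-cong x≈y (φ-cong m x≈y)

    Tr-+ : ∀ x y → Tr m (x + y) ≈ Tr m x + Tr m y
    Tr-+ x y = trans (+-congˡ (φ-+ m x y)) (interchange x y (φ m x) (φ m y))

    Tr-φ : ∀ n x → Tr m (φ n x) ≈ φ n (Tr m x)
    Tr-φ n x = trans (+-congˡ (φ-comm m n x)) (sym (φ-+ n x (φ m x)))

    φ-Tr : ∀ x → φ m (Tr m x) ≈ Tr m x
    φ-Tr x = trans (φ-+ m x (φ m x)) (trans (+-congˡ (φm-involutive x)) (+-comm (φ m x) x))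

    Tr[Tr^k]≈0 : ∀ k x → Tr m (Tr m x ^ k) ≈ 0#
    Tr[Tr^k]≈0 k x = begin
      Tr m x ^ k + φ m (Tr m x ^ k)   ≈⟨ +-congˡ (φ-^ m (Tr m x) k) ⟩
      Tr m x ^ k + φ m (Tr m x) ^ k   ≈⟨ +-congˡ (^-congˡ k (φ-Tr x)) ⟩
      Tr m x ^ k + Tr m x ^ k         ≈⟨ x+x≈0 (Tr m x ^ k) ⟩
      0#                              ∎

    module TraceShear (k i j : ℕ) (δ : Carrier) where

      E : Carrier → Carrier
      E y = (y ^ k + δ) ^ (2 ℕ.^ i) + (y ^ k + δ) ^ (2 ℕ.^ j)

      E-cong : ∀ {y z} → y ≈ z → E y ≈ E z
      E-cong {y} {z} y≈z = +-cong (φ-cong i A-cong) (φ-cong j A-cong)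
        where
        A-cong : y ^ k + δ ≈ z ^ k + δ
        A-cong = +-congʳ (^-congˡ k y≈z)

      d : Carrier
      d = φ i δ + φ j δ

      Tr[d] : Tr m d ≈ φ i (Tr m δ) + φ j (Tr m δ)
      Tr[d] = trans (Tr-+ (φ i δ) (φ j δ)) (+-cong (Tr-φ i δ) (Tr-φ j δ))

      Tr∘E∘Tr : ∀ x → Tr m (E (Tr m x)) ≈ Tr m d
      Tr∘E∘Tr x = begin
        Tr m (φ i A + φ j A)             ≈⟨ Tr-+ (φ i A) (φ j A) ⟩
        Tr m (φ i A) + Tr m (φ j A)      ≈⟨ +-cong (Tr-φ i A) (Tr-φ j A) ⟩
        φ i (Tr m A) + φ j (Tr m A)      ≈⟨ +-cong (φ-cong i Tr[A]) (φ-cong j Tr[A]) ⟩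
        φ i (Tr m δ) + φ j (Tr m δ)      ≈⟨ Tr[d] ⟨
        Tr m d                           ∎
        where
        A : Carrier
        A = Tr m x ^ k + δ
        Tr[A] : Tr m A ≈ Tr m δ
        Tr[A] = begin
          Tr m A                      ≈⟨ Tr-+ (Tr m x ^ k) δ ⟩
          Tr m (Tr m x ^ k) + Tr m δ  ≈⟨ +-congʳ (Tr[Tr^k]≈0 k x) ⟩
          0# + Tr m δ                 ≈⟨ +-identityˡ (Tr m δ) ⟩
          Tr m δ                      ∎

      Cconst≈Tr[d] : Cconst m i j δ ≈ Tr m d
      Cconst≈Tr[d] = begin
        φ i δ + φ (i ℕ.+ m) δ + φ j δ + φ (j ℕ.+ m) δ        ≈⟨ +-assoc _ (φ j δ) _ ⟩
        φ i δ + φ (i ℕ.+ m) δ + (φ j δ + φ (j ℕ.+ m) δ)      ≈⟨ +-cong (φ[Trδ] i) (φ[Trδ] j) ⟨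
        φ i (Tr m δ) + φ j (Tr m δ)                          ≈⟨ Tr[d] ⟨
        Tr m d                                               ∎
        where
        φ[Trδ] : ∀ n → φ n (Tr m δ) ≈ φ n δ + φ (n ℕ.+ m) δ
        φ[Trδ] n = trans (φ-+ n δ (φ m δ)) (+-congˡ (φ∘φ n m δ))

      fPoly-shear : ∀ x → fPoly m k i j δ x ≈ x + E (Tr m x)
      fPoly-shear x = +-assoc x _ _

      gPoly-shear : ∀ x → gPoly m k i j δ x ≈ x + E (Tr m x + Tr m d)
      gPoly-shear x = trans (+-assoc x _ _) (+-congˡ (E-cong (+-congˡ Cconst≈Tr[d])))

open import Data.Nat using (ℕ; _≤_; _+_; _*_; _^_)

theorem12 : ∀ {c ℓ} (R : CommutativeRing c ℓ) (m k i j : ℕ)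
    → 1 ≤ m → 1 ≤ k → i ≢ j
    → IsFiniteFieldOfOrder R (2 ^ (2 * m))
    → (δ : CommutativeRing.Carrier R)
    → FieldOps.IsPermutationWithInverse R
        (FieldOps.fPoly R m k i j δ) (FieldOps.gPoly R m k i j δ)
theorem12 R m k i j (s≤s z≤n) _ _ (isField , enumeration) δ =
  shear-inverse +-abelianGroup x+x≈0
    (Tr m) Tr-cong Tr-+ E E-cong d Tr∘E∘Tr fPoly-shear gPoly-shear
  where
  open CommutativeRing R using (_≈_; +-abelianGroup)
  open FieldOps R using (Tr) renaming (_^_ to _^ᴿ_)
  fermat : ∀ x → x ^ᴿ (2 ^ (2 * m)) ≈ x
  fermat = FiniteField.fermat R isField enumeration
  x+x≈0 : HasCharacteristicTwo R
  x+x≈0 = x^[2^[1+n]]≈x⇒characteristic-two R (ℕ.pred (2 * m)) fermat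
  open Frobenius R x+x≈0
  open Trace m (φ[2m]≈id⇒φm-involutive m fermat)
  open TraceShear k i j δ
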